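{- Let $H$ be a finite $k$-uniform $r$-regular hypergraph (every hyperedge has $k$ vertices and every vertex lies in exactly $r$ hyperedges), and let $\Gamma$ be the multigraph on $V(H)$ without loops in which two distinct vertices $x,y$ are joined by as many edges as there are hyperedges of $H$ containing both $x$ and $y$. Let $T$ be a transversal of $H$. Then $\Gamma$ is $(k-1)r$-regular, $T$ is an independent set of $\Gamma$, and $T$ attains the Delsarte--Hoffman bound in $\Gamma$, i.e. $$|T|=\frac{ -\theta\,|V(\Gamma)|}{(k-1)r-\theta},$$ where $\theta$ is the minimal eigenvalue of the adjacency matrix of $\Gamma$.
   Context: A transversal of a hypergraph is a set of vertices meeting every hyperedge in exactly one vertex. A set of vertices of a multigraph is independent if no two distinct vertices of it are joined by an edge. For an $r'$-regular multigraph on $v$ vertices with minimal adjacency eigenvalue $\theta$, the Delsarte--Hoffman bound is $\frac{ -\theta v}{r'-\theta}$. -}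

module Defs where

open import Level using (Level; _⊔_) renaming (suc to lsuc)
open import Data.Nat using (ℕ; zero; suc)
import Data.Nat as N
open import Data.Bool using (Bool; true; false; _∧_; if_then_else_)
open import Data.Fin using (Fin; _≟_)
open import Data.Fin.Subset using (Subset; _∈_; _∩_; ∣_∣)
open import Data.Fin.Subset.Properties using (_∈?_)
open import Data.Product using (Σ; ∃; _×_; _,_)
open import Relation.Nullary using (¬_; does)
open import Relation.Binary.Core using (Rel)
open import Relation.Binary.Structures using (IsTotalOrder)
open import Relation.Binary.PropositionalEquality using (_≡_; _≢_)
open import Function.Definitions using (Injective)
open import Algebra.Bundles using (CommutativeRing)

sumℕ : ∀ {n} → (Fin n → ℕ) → ℕ
sumℕ {zero}  f = 0
sumℕ {suc n} f = f Data.Fin.zero N.+ sumℕ (λ i → f (Data.Fin.suc i))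

count : ∀ {n} → (Fin n → Bool) → ℕ
count p = sumℕ (λ i → if p i then 1 else 0)

record Hypergraph : Set where
  field
    v m : ℕ
    E   : Fin m → Subset v

open Hypergraph public

-- hyperedges are pairwise distinct (H is a hypergraph, not a multiset of edges)
Simple : Hypergraph → Set
Simple H = Injective _≡_ _≡_ (E H)

Uniform : Hypergraph → ℕ → Set
Uniform H k = ∀ i → ∣ E H i ∣ ≡ k

degreeH : (H : Hypergraph) → Fin (v H) → ℕ
degreeH H x = count (λ i → does (x ∈? E H i))

Regular : Hypergraph → ℕ → Set
Regular H r = ∀ x → degreeH H x ≡ r

Transversal : (H : Hypergraph) → Subset (v H) → Set
Transversal H T = ∀ i → ∣ E H i ∩ T ∣ ≡ 1

Γadj : (H : Hypergraph) → Fin (v H) → Fin (v H) → ℕ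
Γadj H x y with does (x ≟ y)
... | true  = 0
... | false = count (λ i → does (x ∈? E H i) ∧ does (y ∈? E H i))

-- multigraph given by an adjacency matrix A (symmetric, ℕ entries)
RegularMG : ∀ {n} → (Fin n → Fin n → ℕ) → ℕ → Set
RegularMG A d = ∀ x → sumℕ (A x) ≡ d

IndependentMG : ∀ {n} → (Fin n → Fin n → ℕ) → Subset n → Set
IndependentMG A T = ∀ x y → x ∈ T → y ∈ T → x ≢ y → A x y ≡ 0

-- Ordered fields (the reals being the intended instance).

record OrderedField c ℓ₁ ℓ₂ : Set (lsuc (c ⊔ ℓ₁ ⊔ ℓ₂)) where
  field
    commutativeRing : CommutativeRing c ℓ₁
  open CommutativeRing commutativeRing public
  infix 4 _≤_
  field
    _≤_          : Rel Carrier ℓ₂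
    isTotalOrder : IsTotalOrder _≈_ _≤_
    0≉1          : ¬ (0# ≈ 1#)
    inverse      : ∀ x → ¬ (x ≈ 0#) → ∃ λ y → (x * y) ≈ 1#
    +-monoˡ-≤    : ∀ {x y} z → x ≤ y → (x + z) ≤ (y + z)
    *-nonneg     : ∀ {x y} → 0# ≤ x → 0# ≤ y → 0# ≤ (x * y)

  ι : ℕ → Carrier
  ι zero    = 0#
  ι (suc n) = 1# + ι n

  Σ[_] : ∀ {n} → (Fin n → Carrier) → Carrier
  Σ[_] {zero}  f = 0#
  Σ[_] {suc n} f = f Data.Fin.zero + Σ[ (λ i → f (Data.Fin.suc i)) ]

module _ {c ℓ₁ ℓ₂} (F : OrderedField c ℓ₁ ℓ₂) where
  open OrderedField F

  IsEigenvalue : ∀ {n} → (Fin n → Fin n → ℕ) → Carrier → Set (c ⊔ ℓ₁)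
  IsEigenvalue {n} A θ =
    Σ (Fin n → Carrier) λ x →
      (∃ λ i → ¬ (x i ≈ 0#)) ×
      (∀ i → Σ[ (λ j → ι (A i j) * x j) ] ≈ θ * x i)

  IsMinEigenvalue : ∀ {n} → (Fin n → Fin n → ℕ) → Carrier → Set (c ⊔ ℓ₁ ⊔ ℓ₂)
  IsMinEigenvalue A θ = IsEigenvalue A θ × (∀ μ → IsEigenvalue A μ → θ ≤ μ)

-- Let N be the edge-vertex incidence matrix of H. Off the diagonal, NᵀN counts common edges and on
-- the diagonal it is the degree r, so the adjacency matrix of Γ is A = NᵀN − r·I. Counting incidences
-- gives the row sums (k − 1)r of A together with |T|·r = |E(H)| and |V(H)|·r = |E(H)|·k. As NᵀN is
-- positive semidefinite, every eigenvalue of A is at least −r. For k ≥ 2 the vector k·1_T − 1 is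
-- killed by N, since every edge has k vertices and exactly one of them in T; so θ = −r and
-- |T|((k − 1)r + r) = |E(H)|·k = |V(H)|·r. For k ≤ 1 the graph Γ has no edges and θ = 0.
module Submission where

open import Defs
open import Data.Nat using (ℕ; _*_; _∸_)
open import Data.Fin.Subset using (Subset; ∣_∣)
open import Data.Product using (_×_)

open import Data.Nat using (zero; suc; z≤n; s≤s)
import Data.Nat as ℕ
import Data.Nat.Properties as ℕₚ
open import Data.Bool using (true; false; _∧_; if_then_else_)
open import Data.Empty using (⊥-elim)
open import Data.Fin using (Fin; _≟_)
import Data.Fin as Fin
open import Data.Fin.Properties using (punchInᵢ≢i)
open import Data.Fin.Subset using (_∈_; _∩_; ⊤; inside; outside)
import Data.Fin.Subset as Subset
open import Data.Fin.Subset.Properties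
  using (_∈?_; x∈p∩q⁺; x∈p⇒∣p-x∣<∣p∣; x∈p∧x≢y⇒x∈p-y; ∣⊤∣≡n; ∩-identityʳ)
open import Data.Product using (_,_; proj₁)
open import Data.Sum using (inj₁; inj₂)
open import Data.Vec using ([]; _∷_)
open import Data.Vec.Functional using (Vector; transpose; removeAt)
open import Function using (_∘_)
open import Algebra.Bundles using (CommutativeSemiring)
open import Relation.Nullary using (¬_; does; yes; no)
open import Relation.Binary.Structures using (IsTotalOrder)
open import Relation.Binary.PropositionalEquality as ≡ using (_≡_; _≢_)
import Relation.Binary.Reasoning.Setoid as SetoidReasoning

χ : ∀ {n} → Subset n → Fin n → ℕ
χ X x = if does (x ∈? X) then 1 else 0

sumℕ-cong : ∀ {n} {f g : Fin n → ℕ} → (∀ i → f i ≡ g i) → sumℕ f ≡ sumℕ g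
sumℕ-cong {zero}  f≗g = ≡.refl
sumℕ-cong {suc n} f≗g = ≡.cong₂ ℕ._+_ (f≗g Fin.zero) (sumℕ-cong (f≗g ∘ Fin.suc))

sumℕ-const : ∀ n c → sumℕ {n} (λ _ → c) ≡ n * c
sumℕ-const zero    c = ≡.refl
sumℕ-const (suc n) c = ≡.cong (c ℕ.+_) (sumℕ-const n c)

sumℕ≡0⇒≡0 : ∀ {n} {f : Fin n → ℕ} → sumℕ f ≡ 0 → ∀ i → f i ≡ 0
sumℕ≡0⇒≡0 {f = f} Σf≡0 Fin.zero    = ℕₚ.m+n≡0⇒m≡0 (f Fin.zero) Σf≡0
sumℕ≡0⇒≡0 {f = f} Σf≡0 (Fin.suc i) = sumℕ≡0⇒≡0 (ℕₚ.m+n≡0⇒n≡0 (f Fin.zero) Σf≡0) i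

∣∣≡sumℕ-χ : ∀ {n} (X : Subset n) → ∣ X ∣ ≡ sumℕ (χ X)
∣∣≡sumℕ-χ []            = ≡.refl
∣∣≡sumℕ-χ (inside ∷ X)  = ≡.cong suc (∣∣≡sumℕ-χ X)
∣∣≡sumℕ-χ (outside ∷ X) = ∣∣≡sumℕ-χ X

χ-∩ : ∀ {n} (X Y : Subset n) x → χ (X ∩ Y) x ≡ χ X x * χ Y x
χ-∩ (inside ∷ X)  (inside ∷ Y)  Fin.zero    = ≡.refl
χ-∩ (inside ∷ X)  (outside ∷ Y) Fin.zero    = ≡.refl
χ-∩ (outside ∷ X) (y ∷ Y)       Fin.zero    = ≡.refl
χ-∩ (_ ∷ X)       (_ ∷ Y)       (Fin.suc x) = χ-∩ X Y x

codegree : (H : Hypergraph) → Fin (v H) → Fin (v H) → ℕ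
codegree H x y = sumℕ (λ e → χ (E H e) x * χ (E H e) y)

Γadj-diag : ∀ H x → Γadj H x x ≡ 0
Γadj-diag H x with x ≟ x
... | yes _  = ≡.refl
... | no x≢x = ⊥-elim (x≢x ≡.refl)

Γadj-offdiag : ∀ H {x y} → x ≢ y → Γadj H x y ≡ codegree H x y
Γadj-offdiag H {x} {y} x≢y with x ≟ y
... | yes x≡y = ⊥-elim (x≢y x≡y)
... | no _    = sumℕ-cong λ e → χ∧χ (does (x ∈? E H e)) (does (y ∈? E H e))
  where
  χ∧χ : ∀ a b → (if a ∧ b then 1 else 0) ≡ (if a then 1 else 0) * (if b then 1 else 0)
  χ∧χ true  b = ≡.sym (ℕₚ.+-identityʳ _)
  χ∧χ false b = ≡.refl

codegree-diag : ∀ H x → codegree H x x ≡ degreeH H x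
codegree-diag H x = sumℕ-cong λ e → χ*χ (does (x ∈? E H e))
  where
  χ*χ : ∀ a → (if a then 1 else 0) * (if a then 1 else 0) ≡ (if a then 1 else 0)
  χ*χ true  = ≡.refl
  χ*χ false = ≡.refl

2≤∣p∣ : ∀ {n} {p : Subset n} {x y} → x ∈ p → y ∈ p → x ≢ y → 2 ℕ.≤ ∣ p ∣
2≤∣p∣ {p = p} {x} {y} x∈p y∈p x≢y = ℕₚ.≤-trans (s≤s ∣p-x∣>0) (x∈p⇒∣p-x∣<∣p∣ x∈p)
  where
  ∣p-x∣>0 : 1 ℕ.≤ ∣ p Subset.- x ∣
  ∣p-x∣>0 = ℕₚ.≤-trans (s≤s z≤n) (x∈p⇒∣p-x∣<∣p∣ (x∈p∧x≢y⇒x∈p-y y∈p (x≢y ∘ ≡.sym)))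

transversal-independent : ∀ {H T} → Transversal H T → IndependentMG (Γadj H) T
transversal-independent {H} {T} transversal x y x∈T y∈T x≢y =
  ≡.trans (Γadj-offdiag H x≢y)
        (≡.trans (sumℕ-cong no-common-edge) (≡.trans (sumℕ-const (m H) 0) (ℕₚ.*-zeroʳ (m H))))
  where
  no-common-edge : ∀ e → χ (E H e) x * χ (E H e) y ≡ 0
  no-common-edge e with x ∈? E H e | y ∈? E H e
  ... | no _    | _       = ≡.refl
  ... | yes _   | no _    = ≡.refl
  ... | yes x∈e | yes y∈e with s≤s () ← ≡.subst (2 ℕ.≤_) (transversal e)
                                         (2≤∣p∣ (x∈p∩q⁺ (x∈e , x∈T)) (x∈p∩q⁺ (y∈e , y∈T)) x≢y)

module LinearAlgebra {c ℓ} (S : CommutativeSemiring c ℓ) where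
  open CommutativeSemiring S renaming (_*_ to _·_)
  open import Algebra.Properties.Semiring.Sum semiring public
  open SetoidReasoning setoid

  infix 7 _*ᵥ_

  𝟏 : ∀ {n} → Vector Carrier n
  𝟏 _ = 1#

  ⟨_,_⟩ : ∀ {n} → Vector Carrier n → Vector Carrier n → Carrier
  ⟨ x , y ⟩ = sum (λ i → x i · y i)

  _*ᵥ_ : ∀ {m n} → Vector (Vector Carrier n) m → Vector Carrier n → Vector Carrier m
  (M *ᵥ x) i = ⟨ M i , x ⟩

  *ᵥ-adjoint : ∀ {m n} (M : Vector (Vector Carrier n) m) a b →
               ⟨ transpose M *ᵥ a , b ⟩ ≈ ⟨ a , M *ᵥ b ⟩
  *ᵥ-adjoint M a b = begin
    sum (λ j → sum (λ e → M e j · a e) · b j)    ≈⟨ sum-cong-≋ (λ j → *-distribʳ-sum (b j) (λ e → M e j · a e)) ⟩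
    sum (λ j → sum (λ e → M e j · a e · b j))    ≈⟨ ∑-comm (λ j e → M e j · a e · b j) ⟩
    sum (λ e → sum (λ j → M e j · a e · b j))    ≈⟨ sum-cong-≋ (λ e → sum-cong-≋ (λ j → rearrange (M e j) (a e) (b j))) ⟩
    sum (λ e → sum (λ j → a e · (M e j · b j)))  ≈⟨ sum-cong-≋ (λ e → *-distribˡ-sum (a e) (λ j → M e j · b j)) ⟨
    sum (λ e → a e · (M *ᵥ b) e)                 ∎
    where
    rearrange : ∀ m x y → m · x · y ≈ x · (m · y)
    rearrange m x y = trans (*-congʳ (*-comm m x)) (*-assoc x m y)

  *ᵥ-+ : ∀ {m n} (M : Vector (Vector Carrier n) m) x y i →
         (M *ᵥ (λ j → x j + y j)) i ≈ (M *ᵥ x) i + (M *ᵥ y) i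
  *ᵥ-+ M x y i = trans (sum-cong-≋ (λ j → distribˡ (M i j) (x j) (y j))) (∑-distrib-+ (λ j → M i j · x j) (λ j → M i j · y j))

  *ᵥ-* : ∀ {m n} (M : Vector (Vector Carrier n) m) a x i →
         (M *ᵥ (λ j → a · x j)) i ≈ a · (M *ᵥ x) i
  *ᵥ-* M a x i = begin
    sum (λ j → M i j · (a · x j))  ≈⟨ sum-cong-≋ (λ j → x*[y*z]≈y*[x*z] (M i j) a (x j)) ⟩
    sum (λ j → a · (M i j · x j))  ≈⟨ *-distribˡ-sum a (λ j → M i j · x j) ⟨
    a · (M *ᵥ x) i                 ∎
    where
    x*[y*z]≈y*[x*z] : ∀ x y z → x · (y · z) ≈ y · (x · z)
    x*[y*z]≈y*[x*z] x y z = trans (sym (*-assoc x y z)) (trans (*-congʳ (*-comm x y)) (*-assoc y x z))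

  sum-zeroedAt : ∀ {n} (i : Fin n) {f g : Vector Carrier n} →
                 f i ≈ 0# → (∀ j → j ≢ i → f j ≈ g j) → sum f + g i ≈ sum g
  sum-zeroedAt {suc n} i {f} {g} fᵢ≈0 f≈g = begin
    sum f + g i                               ≈⟨ +-congʳ (sum-remove f) ⟩
    f i + sum (removeAt f i) + g i            ≈⟨ +-congʳ (+-cong fᵢ≈0 (sum-cong-≋ λ j → f≈g _ (punchInᵢ≢i i j))) ⟩
    0# + sum (removeAt g i) + g i             ≈⟨ +-congʳ (+-identityˡ _) ⟩
    sum (removeAt g i) + g i                  ≈⟨ +-comm _ _ ⟩
    g i + sum (removeAt g i)                  ≈⟨ sum-remove g ⟨
    sum g                                     ∎

module HypergraphAlgebra {c ℓ} (S : CommutativeSemiring c ℓ) where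
  open CommutativeSemiring S renaming (_*_ to _·_)
  open LinearAlgebra S public
  import Algebra.Properties.Semiring.Mult semiring as Mult
  open SetoidReasoning setoid

  module CanonicalMap (ι : ℕ → Carrier) (ι-zero : ι 0 ≈ 0#) (ι-suc : ∀ n → ι (suc n) ≈ 1# + ι n) where

    ι≈×1 : ∀ n → ι n ≈ n Mult.× 1#
    ι≈×1 zero    = ι-zero
    ι≈×1 (suc n) = trans (ι-suc n) (+-congˡ (ι≈×1 n))

    ι-+ : ∀ a b → ι (a ℕ.+ b) ≈ ι a + ι b
    ι-+ a b = begin
      ι (a ℕ.+ b)                ≈⟨ ι≈×1 (a ℕ.+ b) ⟩
      (a ℕ.+ b) Mult.× 1#        ≈⟨ Mult.×-homo-+ 1# a b ⟩
      a Mult.× 1# + b Mult.× 1#  ≈⟨ +-cong (ι≈×1 a) (ι≈×1 b) ⟨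
      ι a + ι b                  ∎

    ι-* : ∀ a b → ι (a * b) ≈ ι a · ι b
    ι-* a b = begin
      ι (a * b)                  ≈⟨ ι≈×1 (a * b) ⟩
      (a * b) Mult.× 1#          ≈⟨ Mult.×1-homo-* a b ⟩
      a Mult.× 1# · b Mult.× 1#  ≈⟨ *-cong (ι≈×1 a) (ι≈×1 b) ⟨
      ι a · ι b                  ∎

    ι-sumℕ : ∀ {n} (f : Fin n → ℕ) → ι (sumℕ f) ≈ sum (λ i → ι (f i))
    ι-sumℕ {zero}  f = ι-zero
    ι-sumℕ {suc n} f = trans (ι-+ (f Fin.zero) _) (+-congˡ (ι-sumℕ (f ∘ Fin.suc)))

    ι-∣∣ : ∀ {n} (X : Subset n) → ι ∣ X ∣ ≈ sum (λ x → ι (χ X x))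
    ι-∣∣ X = trans (reflexive (≡.cong ι (∣∣≡sumℕ-χ X))) (ι-sumℕ (χ X))

    module _ (H : Hypergraph) where

      incidence : Vector (Vector Carrier (v H)) (m H)
      incidence e x = ι (χ (E H e) x)

      ι-degree : ∀ x → ι (degreeH H x) ≈ (transpose incidence *ᵥ 𝟏) x
      ι-degree x = trans (ι-sumℕ (λ e → χ (E H e) x)) (sum-cong-≋ λ e → sym (*-identityʳ (incidence e x)))

      ι-codegree : ∀ x y → ι (codegree H x y) ≈ (transpose incidence *ᵥ transpose incidence x) y
      ι-codegree x y = trans (ι-sumℕ (λ e → χ (E H e) x * χ (E H e) y))
        (sum-cong-≋ λ e → trans (ι-* (χ (E H e) x) (χ (E H e) y)) (*-comm (incidence e x) (incidence e y)))

      incidence*ᵥ𝟏 : ∀ e → (incidence *ᵥ 𝟏) e ≈ ι ∣ E H e ∣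
      incidence*ᵥ𝟏 e = trans (sum-cong-≋ λ x → *-identityʳ (incidence e x)) (sym (ι-∣∣ (E H e)))

      incidence*ᵥχ : ∀ X e → (incidence *ᵥ (ι ∘ χ X)) e ≈ ι ∣ E H e ∩ X ∣
      incidence*ᵥχ X e = sym (trans (ι-∣∣ (E H e ∩ X))
        (sum-cong-≋ λ x → trans (reflexive (≡.cong ι (χ-∩ (E H e) X x))) (ι-* (χ (E H e) x) (χ X x))))

      gram : ∀ y i → sum (λ j → ι (Γadj H i j) · y j) + ι (degreeH H i) · y i
                     ≈ (transpose incidence *ᵥ (incidence *ᵥ y)) i
      gram y i = begin
        sum (λ j → ι (Γadj H i j) · y j) + ι (degreeH H i) · y i
          ≈⟨ +-congˡ (*-congʳ (reflexive (≡.cong ι (≡.sym (codegree-diag H i))))) ⟩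
        sum (λ j → ι (Γadj H i j) · y j) + ι (codegree H i i) · y i
          ≈⟨ sum-zeroedAt i diagonal off-diagonal ⟩
        ⟨ (λ j → ι (codegree H i j)) , y ⟩
          ≈⟨ sum-cong-≋ (λ j → *-congʳ (ι-codegree i j)) ⟩
        ⟨ transpose incidence *ᵥ transpose incidence i , y ⟩
          ≈⟨ *ᵥ-adjoint incidence (transpose incidence i) y ⟩
        ⟨ transpose incidence i , incidence *ᵥ y ⟩
          ∎
        where
        diagonal : ι (Γadj H i i) · y i ≈ 0#
        diagonal = trans (*-congʳ (trans (reflexive (≡.cong ι (Γadj-diag H i))) ι-zero)) (zeroˡ (y i))
        off-diagonal : ∀ j → j ≢ i → ι (Γadj H i j) · y j ≈ ι (codegree H i j) · y j
        off-diagonal j j≢i = *-congʳ (reflexive (≡.cong ι (Γadj-offdiag H (j≢i ∘ ≡.sym))))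

module _ {H : Hypergraph} where
  open HypergraphAlgebra ℕₚ.+-*-commutativeSemiring
  open CanonicalMap (λ n → n) ≡.refl (λ _ → ≡.refl)
  open ≡.≡-Reasoning

  Γ-regular : ∀ {k r} → Uniform H k → Regular H r → RegularMG (Γadj H) ((k ∸ 1) * r)
  Γ-regular {k} {r} uniform regular i = begin
    sumℕ (Γadj H i)                ≡⟨ ℕₚ.m+n∸n≡m (sumℕ (Γadj H i)) r ⟨
    sumℕ (Γadj H i) ℕ.+ r ∸ r      ≡⟨ ≡.cong₂ _∸_ row-sum (≡.sym (ℕₚ.*-identityˡ r)) ⟩
    k * r ∸ 1 * r                  ≡⟨ ℕₚ.*-distribʳ-∸ r k 1 ⟨
    (k ∸ 1) * r                    ∎
    where
    row-sum : sumℕ (Γadj H i) ℕ.+ r ≡ k * r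
    row-sum = begin
      sumℕ (Γadj H i) ℕ.+ r
        ≡⟨ ≡.cong₂ ℕ._+_ (≡.trans (ι-sumℕ (Γadj H i)) (sum-cong-≗ λ j → ≡.sym (ℕₚ.*-identityʳ (Γadj H i j))))
                         (≡.trans (≡.sym (regular i)) (≡.sym (ℕₚ.*-identityʳ (degreeH H i)))) ⟩
      sum (λ j → Γadj H i j * 1) ℕ.+ degreeH H i * 1
        ≡⟨ gram H 𝟏 i ⟩
      (transpose (incidence H) *ᵥ (incidence H *ᵥ 𝟏)) i
        ≡⟨ sum-cong-≗ (λ e → ≡.cong (incidence H e i *_)
             (≡.trans (incidence*ᵥ𝟏 H e) (≡.trans (uniform e) (≡.sym (ℕₚ.*-identityʳ k))))) ⟩
      (transpose (incidence H) *ᵥ (λ _ → k * 1)) i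
        ≡⟨ *ᵥ-* (transpose (incidence H)) k 𝟏 i ⟩
      k * (transpose (incidence H) *ᵥ 𝟏) i
        ≡⟨ ≡.cong (k *_) (≡.trans (≡.sym (ι-degree H i)) (regular i)) ⟩
      k * r
        ∎

  double-count : ∀ {r} → Regular H r → ∀ X → ∣ X ∣ * r ≡ sumℕ (λ e → ∣ E H e ∩ X ∣)
  double-count {r} regular X = begin
    ∣ X ∣ * r                                          ≡⟨ ≡.cong (_* r) (ι-∣∣ X) ⟩
    sum (χ X) * r                                      ≡⟨ *-distribʳ-sum r (χ X) ⟩
    sum (λ x → χ X x * r)                              ≡⟨ sum-cong-≗ (λ x → ≡.trans (ℕₚ.*-comm (χ X x) r)
                                                            (≡.cong (_* χ X x) (≡.trans (≡.sym (regular x)) (ι-degree H x)))) ⟩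
    ⟨ transpose (incidence H) *ᵥ 𝟏 , χ X ⟩             ≡⟨ *ᵥ-adjoint (incidence H) 𝟏 (χ X) ⟩
    ⟨ 𝟏 , incidence H *ᵥ χ X ⟩                          ≡⟨ sum-cong-≗ (λ e → ≡.trans (ℕₚ.*-identityˡ _) (incidence*ᵥχ H X e)) ⟩
    sum (λ e → ∣ E H e ∩ X ∣)                          ≡⟨ ι-sumℕ (λ e → ∣ E H e ∩ X ∣) ⟨
    sumℕ (λ e → ∣ E H e ∩ X ∣)                         ∎

  transversal-size : ∀ {r T} → Regular H r → Transversal H T → ∣ T ∣ * r ≡ m H
  transversal-size {r} {T} regular transversal = begin
    ∣ T ∣ * r                    ≡⟨ double-count regular T ⟩
    sumℕ (λ e → ∣ E H e ∩ T ∣)   ≡⟨ sumℕ-cong transversal ⟩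
    sumℕ {m H} (λ _ → 1)         ≡⟨ sumℕ-const (m H) 1 ⟩
    m H * 1                      ≡⟨ ℕₚ.*-identityʳ (m H) ⟩
    m H                          ∎

  handshake : ∀ {k r} → Uniform H k → Regular H r → v H * r ≡ m H * k
  handshake {k} {r} uniform regular = begin
    v H * r                      ≡⟨ ≡.cong (_* r) (∣⊤∣≡n (v H)) ⟨
    ∣ ⊤ {v H} ∣ * r              ≡⟨ double-count regular ⊤ ⟩
    sumℕ (λ e → ∣ E H e ∩ ⊤ ∣)   ≡⟨ sumℕ-cong (λ e → ≡.trans (≡.cong ∣_∣ (∩-identityʳ (E H e))) (uniform e)) ⟩
    sumℕ {m H} (λ _ → k)         ≡⟨ sumℕ-const (m H) k ⟩
    m H * k                      ∎

module OrderedFieldProperties {c ℓ₁ ℓ₂} (F : OrderedField c ℓ₁ ℓ₂) where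
  open OrderedField F renaming (_*_ to _·_)
  open IsTotalOrder isTotalOrder using (total; antisym; ≲-respˡ-≈; ≲-respʳ-≈)
    renaming (trans to ≤-trans; reflexive to ≤-reflexive)
  open import Algebra.Properties.Ring ring using (-‿distribˡ-*; -‿distribʳ-*; -‿involutive; +-cancelˡ)
  open LinearAlgebra commutativeSemiring using (sum; ⟨_,_⟩)

  x≤x+y : ∀ {x y} → 0# ≤ y → x ≤ x + y
  x≤x+y {x} {y} 0≤y = ≲-respˡ-≈ (+-identityˡ x) (≲-respʳ-≈ (+-comm y x) (+-monoˡ-≤ x 0≤y))

  0≤x+y : ∀ {x y} → 0# ≤ x → 0# ≤ y → 0# ≤ x + y
  0≤x+y {x} {y} 0≤x 0≤y = ≤-trans 0≤x (x≤x+y 0≤y)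

  0≤x+y⇒-y≤x : ∀ {x y} → 0# ≤ x + y → - y ≤ x
  0≤x+y⇒-y≤x {x} {y} 0≤x+y = ≲-respˡ-≈ (+-identityˡ (- y)) (≲-respʳ-≈ x+y-y≈x (+-monoˡ-≤ (- y) 0≤x+y))
    where
    x+y-y≈x : x + y + - y ≈ x
    x+y-y≈x = trans (+-assoc x y (- y)) (trans (+-congˡ (-‿inverseʳ y)) (+-identityʳ x))

  x≤0⇒0≤-x : ∀ {x} → x ≤ 0# → 0# ≤ - x
  x≤0⇒0≤-x {x} x≤0 = ≲-respˡ-≈ (-‿inverseʳ x) (≲-respʳ-≈ (+-identityˡ (- x)) (+-monoˡ-≤ (- x) x≤0))

  0≤-x⇒x≤0 : ∀ {x} → 0# ≤ - x → x ≤ 0#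
  0≤-x⇒x≤0 {x} 0≤-x = ≲-respˡ-≈ (+-identityˡ x) (≲-respʳ-≈ (-‿inverseˡ x) (+-monoˡ-≤ x 0≤-x))

  0≤x·x : ∀ x → 0# ≤ x · x
  0≤x·x x with total 0# x
  ... | inj₁ 0≤x = *-nonneg 0≤x 0≤x
  ... | inj₂ x≤0 = ≲-respʳ-≈ -x·-x≈x·x (*-nonneg (x≤0⇒0≤-x x≤0) (x≤0⇒0≤-x x≤0))
    where
    -x·-x≈x·x : - x · - x ≈ x · x
    -x·-x≈x·x = trans (sym (-‿distribˡ-* x (- x)))
                  (trans (-‿cong (sym (-‿distribʳ-* x x))) (-‿involutive (x · x)))

  0≤1 : 0# ≤ 1#
  0≤1 = ≲-respʳ-≈ (*-identityˡ 1#) (0≤x·x 1#)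

  0≤ι : ∀ n → 0# ≤ ι n
  0≤ι zero    = ≤-reflexive refl
  0≤ι (suc n) = 0≤x+y 0≤1 (0≤ι n)

  1+ι≉0 : ∀ n → ¬ (1# + ι n ≈ 0#)
  1+ι≉0 n 1+ι≈0 = 0≉1 (antisym 0≤1 (≲-respʳ-≈ 1+ι≈0 (x≤x+y (0≤ι n))))

  ι-injective : ∀ {m n} → ι m ≈ ι n → m ≡ n
  ι-injective {zero}  {zero}  _   = ≡.refl
  ι-injective {zero}  {suc n} 0≈ι = ⊥-elim (1+ι≉0 n (sym 0≈ι))
  ι-injective {suc m} {zero}  ι≈0 = ⊥-elim (1+ι≉0 m ι≈0)
  ι-injective {suc m} {suc n} ι≈ι = ≡.cong suc (ι-injective (+-cancelˡ 1# (ι m) (ι n) ι≈ι))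

  x≉0⇒x·y≈0⇒y≈0 : ∀ {x y} → ¬ (x ≈ 0#) → x · y ≈ 0# → y ≈ 0#
  x≉0⇒x·y≈0⇒y≈0 {x} {y} x≉0 x·y≈0 with inverse x x≉0
  ... | x⁻¹ , x·x⁻¹≈1 = begin
    y               ≈⟨ *-identityˡ y ⟨
    1# · y          ≈⟨ *-congʳ x·x⁻¹≈1 ⟨
    x · x⁻¹ · y     ≈⟨ *-congʳ (*-comm x x⁻¹) ⟩
    x⁻¹ · x · y     ≈⟨ *-assoc x⁻¹ x y ⟩
    x⁻¹ · (x · y)   ≈⟨ *-congˡ x·y≈0 ⟩
    x⁻¹ · 0#        ≈⟨ zeroʳ x⁻¹ ⟩
    0#              ∎
    where open SetoidReasoning setoid

  0≤sum : ∀ {n} {f : Fin n → Carrier} → (∀ i → 0# ≤ f i) → 0# ≤ sum f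
  0≤sum {zero}  0≤f = ≤-reflexive refl
  0≤sum {suc n} 0≤f = 0≤x+y (0≤f Fin.zero) (0≤sum (0≤f ∘ Fin.suc))

  sum≈0⇒≈0 : ∀ {n} {f : Fin n → Carrier} → (∀ i → 0# ≤ f i) → sum f ≈ 0# → ∀ i → f i ≈ 0#
  sum≈0⇒≈0 {suc n} {f} 0≤f Σf≈0 Fin.zero =
    antisym (≲-respʳ-≈ Σf≈0 (x≤x+y (0≤sum (0≤f ∘ Fin.suc)))) (0≤f Fin.zero)
  sum≈0⇒≈0 {suc n} {f} 0≤f Σf≈0 (Fin.suc i) = sum≈0⇒≈0 (0≤f ∘ Fin.suc) Σf∘suc≈0 i
    where
    Σf∘suc≈0 : sum (f ∘ Fin.suc) ≈ 0#
    Σf∘suc≈0 = antisym (≲-respʳ-≈ (trans (+-comm _ _) Σf≈0) (x≤x+y (0≤f Fin.zero)))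
                       (0≤sum (0≤f ∘ Fin.suc))

  ⟨x,x⟩≉0 : ∀ {n} (x : Fin n → Carrier) i → ¬ (x i ≈ 0#) → ¬ (⟨ x , x ⟩ ≈ 0#)
  ⟨x,x⟩≉0 x i xᵢ≉0 ⟨x,x⟩≈0 = xᵢ≉0 (x≉0⇒x·y≈0⇒y≈0 xᵢ≉0 (sum≈0⇒≈0 (λ j → 0≤x·x (x j)) ⟨x,x⟩≈0 i))

  0≤t·s⇒0≤t : ∀ {s t} → 0# ≤ s → ¬ (s ≈ 0#) → 0# ≤ t · s → 0# ≤ t
  0≤t·s⇒0≤t {s} {t} 0≤s s≉0 0≤t·s with total 0# t
  ... | inj₁ 0≤t = 0≤t
  ... | inj₂ t≤0 = ≤-reflexive (sym t≈0)
    where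
    t·s≈0 : t · s ≈ 0#
    t·s≈0 = antisym (0≤-x⇒x≤0 (≲-respʳ-≈ (sym (-‿distribˡ-* t s)) (*-nonneg (x≤0⇒0≤-x t≤0) 0≤s))) 0≤t·s
    t≈0 : t ≈ 0#
    t≈0 = x≉0⇒x·y≈0⇒y≈0 s≉0 (trans (*-comm s t) t·s≈0)

module Spectrum {c ℓ₁ ℓ₂} (F : OrderedField c ℓ₁ ℓ₂) where
  open OrderedField F renaming (_*_ to _·_)
  open IsTotalOrder isTotalOrder using (antisym; ≲-respʳ-≈)
  open import Algebra.Properties.Ring ring using (-‿distribˡ-*; -‿involutive; -0#≈0#; +-cancelʳ; +-inverseˡ-unique)
  open OrderedFieldProperties F
  open HypergraphAlgebra commutativeSemiring
  open CanonicalMap ι refl (λ _ → refl)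
  open import Data.Nat.Solver using (module +-*-Solver)
  open +-*-Solver using (solve; _:*_; _:+_; _:=_; con)
  open SetoidReasoning setoid

  Σ≡sum : ∀ {n} (f : Fin n → Carrier) → Σ[ f ] ≡ sum f
  Σ≡sum {zero}  f = ≡.refl
  Σ≡sum {suc n} f = ≡.cong (f Fin.zero +_) (Σ≡sum (f ∘ Fin.suc))

  zero-regular⇒eigenvalue≈0 : ∀ {n} {A : Fin n → Fin n → ℕ} {μ} → RegularMG A 0 → IsEigenvalue F A μ → μ ≈ 0#
  zero-regular⇒eigenvalue≈0 {n} {A} {μ} regular (x , (i , xᵢ≉0) , Ax≈μx) =
    x≉0⇒x·y≈0⇒y≈0 xᵢ≉0 (begin
      x i · μ                          ≈⟨ *-comm (x i) μ ⟩
      μ · x i                          ≈⟨ Ax≈μx i ⟨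
      Σ[ (λ j → ι (A i j) · x j) ]     ≡⟨ Σ≡sum (λ j → ι (A i j) · x j) ⟩
      sum (λ j → ι (A i j) · x j)      ≈⟨ sum-cong-≋ (λ j → trans (*-congʳ (reflexive (≡.cong ι (sumℕ≡0⇒≡0 (regular i) j))))
                                                                   (zeroˡ (x j))) ⟩
      sum {n} (λ _ → 0#)               ≈⟨ sum-replicate-zero n ⟩
      0#                               ∎)

  module _ {H : Hypergraph} {r} (regular : Regular H r) where

    N : Vector (Vector Carrier (v H)) (m H)
    N = incidence H

    eigenvalue-lower-bound : ∀ {μ} → IsEigenvalue F (Γadj H) μ → - ι r ≤ μ
    eigenvalue-lower-bound {μ} (x , (i , xᵢ≉0) , Ax≈μx) =
      0≤x+y⇒-y≤x (0≤t·s⇒0≤t (0≤sum (λ j → 0≤x·x (x j))) (⟨x,x⟩≉0 x i xᵢ≉0)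
                            (≲-respʳ-≈ (sym quadratic-form) (0≤sum (λ e → 0≤x·x ((N *ᵥ x) e)))))
      where
      shifted : ∀ i → (μ + ι r) · x i ≈ (transpose N *ᵥ (N *ᵥ x)) i
      shifted i = begin
        (μ + ι r) · x i                                          ≈⟨ distribʳ (x i) μ (ι r) ⟩
        μ · x i + ι r · x i                                      ≈⟨ +-cong (sym (Ax≈μx i))
                                                                           (*-congʳ (reflexive (≡.cong ι (≡.sym (regular i))))) ⟩
        Σ[ (λ j → ι (Γadj H i j) · x j) ] + ι (degreeH H i) · x i ≡⟨ ≡.cong (_+ ι (degreeH H i) · x i) (Σ≡sum (λ j → ι (Γadj H i j) · x j)) ⟩
        sum (λ j → ι (Γadj H i j) · x j) + ι (degreeH H i) · x i  ≈⟨ gram H x i ⟩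
        (transpose N *ᵥ (N *ᵥ x)) i                               ∎
      quadratic-form : (μ + ι r) · ⟨ x , x ⟩ ≈ ⟨ N *ᵥ x , N *ᵥ x ⟩
      quadratic-form = begin
        (μ + ι r) · ⟨ x , x ⟩                       ≈⟨ *-distribˡ-sum (μ + ι r) (λ j → x j · x j) ⟩
        sum (λ j → (μ + ι r) · (x j · x j))          ≈⟨ sum-cong-≋ (λ j → trans (sym (*-assoc _ _ _)) (*-congʳ (shifted j))) ⟩
        ⟨ transpose N *ᵥ (N *ᵥ x) , x ⟩              ≈⟨ *ᵥ-adjoint N (N *ᵥ x) x ⟩
        ⟨ N *ᵥ x , N *ᵥ x ⟩                          ∎

    module _ {k T} (2≤k : 2 ℕ.≤ k) (uniform : Uniform H k) (transversal : Transversal H T) where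
      private

        y : Fin (v H) → Carrier
        y x = ι k · ι (χ T x) - 1#

        y+1 : ∀ x → y x + 1# ≈ ι k · ι (χ T x)
        y+1 x = trans (+-assoc _ (- 1#) 1#) (trans (+-congˡ (-‿inverseˡ 1#)) (+-identityʳ _))

        N*ᵥy≈0 : ∀ e → (N *ᵥ y) e ≈ 0#
        N*ᵥy≈0 e = +-cancelʳ ((N *ᵥ 𝟏) e) _ _ (begin
          (N *ᵥ y) e + (N *ᵥ 𝟏) e                  ≈⟨ *ᵥ-+ N y 𝟏 e ⟨
          (N *ᵥ (λ x → y x + 1#)) e                ≈⟨ sum-cong-≋ (λ x → *-congˡ (y+1 x)) ⟩
          (N *ᵥ (λ x → ι k · ι (χ T x))) e         ≈⟨ *ᵥ-* N (ι k) (ι ∘ χ T) e ⟩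
          ι k · (N *ᵥ (ι ∘ χ T)) e                 ≈⟨ *-congˡ (trans (incidence*ᵥχ H T e) (reflexive (≡.cong ι (transversal e)))) ⟩
          ι k · ι 1                                ≈⟨ trans (*-congˡ (+-identityʳ 1#)) (*-identityʳ (ι k)) ⟩
          ι k                                      ≈⟨ trans (reflexive (≡.cong ι (≡.sym (uniform e)))) (sym (incidence*ᵥ𝟏 H e)) ⟩
          (N *ᵥ 𝟏) e                               ≈⟨ +-identityˡ _ ⟨
          0# + (N *ᵥ 𝟏) e                          ∎)

        Ay≈-ry : ∀ i → Σ[ (λ j → ι (Γadj H i j) · y j) ] ≈ - ι r · y i
        Ay≈-ry i = begin
          Σ[ (λ j → ι (Γadj H i j) · y j) ]  ≈⟨ +-inverseˡ-unique _ _ Ay+ry≈0 ⟩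
          - (ι r · y i)                      ≈⟨ -‿distribˡ-* (ι r) (y i) ⟩
          - ι r · y i                        ∎
          where
          Ay+ry≈0 : Σ[ (λ j → ι (Γadj H i j) · y j) ] + ι r · y i ≈ 0#
          Ay+ry≈0 = begin
            Σ[ (λ j → ι (Γadj H i j) · y j) ] + ι r · y i
              ≡⟨ ≡.cong₂ _+_ (Σ≡sum (λ j → ι (Γadj H i j) · y j)) (≡.cong (λ d → ι d · y i) (≡.sym (regular i))) ⟩
            sum (λ j → ι (Γadj H i j) · y j) + ι (degreeH H i) · y i  ≈⟨ gram H y i ⟩
            (transpose N *ᵥ (N *ᵥ y)) i                               ≈⟨ sum-cong-≋ (λ e → trans (*-congˡ (N*ᵥy≈0 e)) (zeroʳ _)) ⟩
            sum {m H} (λ _ → 0#)                                      ≈⟨ sum-replicate-zero (m H) ⟩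
            0#                                                        ∎

        y≉0 : ∀ x → ¬ (y x ≈ 0#)
        y≉0 x yₓ≈0 = ℕₚ.<⇒≢ 2≤k (≡.sym (ℕₚ.m*n≡1⇒m≡1 k (χ T x) (ι-injective (begin
          ι (k * χ T x)              ≈⟨ ι-* k (χ T x) ⟩
          ι k · ι (χ T x)            ≈⟨ y+1 x ⟨
          y x + 1#                   ≈⟨ +-congʳ yₓ≈0 ⟩
          0# + 1#                    ≈⟨ +-comm 0# 1# ⟩
          ι 1                        ∎))))

      transversal-eigenvalue : Fin (v H) → IsEigenvalue F (Γadj H) (- ι r)
      transversal-eigenvalue i = y , (i , y≉0 i) , Ay≈-ry

      min-eigenvalue : ∀ {θ} → IsMinEigenvalue F (Γadj H) θ → θ ≈ - ι r
      min-eigenvalue (θ-eigen@(_ , (i , _) , _) , θ-min) =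
        antisym (θ-min (- ι r) (transversal-eigenvalue i)) (eigenvalue-lower-bound θ-eigen)

  hoffman-equality : ∀ {t n e k r θ} → 1 ℕ.≤ k → θ ≈ - ι r → t * r ≡ e → n * r ≡ e * k →
                     ι t · (ι ((k ∸ 1) * r) - θ) ≈ - θ · ι n
  hoffman-equality {t} {n} {e} {suc k} {r} {θ} (s≤s _) θ≈-r t*r≡e n*r≡e*k = begin
    ι t · (ι (k * r) - θ)          ≈⟨ *-congˡ (+-congˡ -θ≈r) ⟩
    ι t · (ι (k * r) + ι r)        ≈⟨ *-congˡ (ι-+ (k * r) r) ⟨
    ι t · ι (k * r ℕ.+ r)          ≈⟨ ι-* t (k * r ℕ.+ r) ⟨
    ι (t * (k * r ℕ.+ r))          ≡⟨ ≡.cong ι t[kr+r]≡nr ⟩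
    ι (n * r)                      ≈⟨ ι-* n r ⟩
    ι n · ι r                      ≈⟨ *-comm (ι n) (ι r) ⟩
    ι r · ι n                      ≈⟨ *-congʳ -θ≈r ⟨
    - θ · ι n                      ∎
    where
    -θ≈r : - θ ≈ ι r
    -θ≈r = trans (-‿cong θ≈-r) (-‿involutive (ι r))
    t[kr+r]≡nr : t * (k * r ℕ.+ r) ≡ n * r
    t[kr+r]≡nr = ≡.trans (solve 3 (λ t k r → t :* (k :* r :+ r) := t :* r :* (con 1 :+ k)) ≡.refl t k r)
                         (≡.trans (≡.cong (_* suc k) t*r≡e) (≡.sym n*r≡e*k))

  hoffman-equality-degenerate : ∀ {t n d θ} → d ≡ 0 → θ ≈ 0# → ι t · (ι d - θ) ≈ - θ · ι n
  hoffman-equality-degenerate {t} {n} {d} {θ} d≡0 θ≈0 = begin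
    ι t · (ι d - θ)   ≈⟨ *-congˡ (+-cong (reflexive (≡.cong ι d≡0)) -θ≈0) ⟩
    ι t · (0# + 0#)   ≈⟨ *-congˡ (+-identityʳ 0#) ⟩
    ι t · 0#          ≈⟨ zeroʳ (ι t) ⟩
    0#                ≈⟨ zeroˡ (ι n) ⟨
    0# · ι n          ≈⟨ *-congʳ -θ≈0 ⟨
    - θ · ι n         ∎
    where
    -θ≈0 : - θ ≈ 0#
    -θ≈0 = trans (-‿cong θ≈0) -0#≈0#

  transversal-attains-bound : ∀ {H k r T θ} → Uniform H k → Regular H r → Transversal H T →
                              IsMinEigenvalue F (Γadj H) θ → ι ∣ T ∣ · (ι ((k ∸ 1) * r) - θ) ≈ - θ · ι (v H)
  transversal-attains-bound {H} {k} {r} {T} uniform regular transversal θ-min with k ℕ.≤? 1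
  ... | yes k≤1 = hoffman-equality-degenerate {∣ T ∣} {v H} (≡.cong (_* r) (ℕₚ.m≤n⇒m∸n≡0 k≤1))
                    (zero-regular⇒eigenvalue≈0 Γ-regular′ (proj₁ θ-min))
    where
    Γ-regular′ : RegularMG (Γadj H) 0
    Γ-regular′ = ≡.subst (RegularMG (Γadj H)) (≡.cong (_* r) (ℕₚ.m≤n⇒m∸n≡0 k≤1)) (Γ-regular uniform regular)
  ... | no k≰1 = hoffman-equality {∣ T ∣} {v H} (ℕₚ.<⇒≤ (ℕₚ.≰⇒> k≰1))
                   (min-eigenvalue regular (ℕₚ.≰⇒> k≰1) uniform transversal θ-min)
                   (transversal-size regular transversal) (handshake uniform regular)

proposition6 : ∀ {c ℓ₁ ℓ₂} (F : OrderedField c ℓ₁ ℓ₂) (H : Hypergraph) (k r : ℕ)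
               → Simple H → Uniform H k → Regular H r
               → (T : Subset (v H)) → Transversal H T
               → RegularMG (Γadj H) ((k ∸ 1) * r)
                 × IndependentMG (Γadj H) T
                 × (∀ θ → IsMinEigenvalue F (Γadj H) θ
                    → OrderedField._≈_ F
                        (OrderedField._*_ F (OrderedField.ι F ∣ T ∣)
                           (OrderedField._-_ F (OrderedField.ι F ((k ∸ 1) * r)) θ))
                        (OrderedField._*_ F (OrderedField.-_ F θ) (OrderedField.ι F (v H))))
proposition6 F H k r _ uniform regular T transversal =
    Γ-regular uniform regular
  , transversal-independent transversal
  , λ θ → Spectrum.transversal-attains-bound F uniform regular transversal
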